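{- Let $c,s$ be positive integers and let $(\mathcal C,\mathcal S)$ be a minimal $(c,s)$-normal cover of a $(c,s)$-normal graph $G$ on $n>1$ vertices. If $U\subseteq V(G)$ is a set of clique generators for $\mathcal C$ that is also a set of stable set generators for $\mathcal S$, then $n\geq 2|U|$.
   Context: A $(c,s)$-normal cover of a graph $G$ is a pair $(\mathcal C,\mathcal S)$ where $\mathcal C$ is a set of cliques of size at most $c$ covering all vertices, $\mathcal S$ is a set of stable sets of size at most $s$ covering all vertices, and every clique in $\mathcal C$ meets every stable set in $\mathcal S$. A vertex $v\in C\in\mathcal C$ is private to $C$ if it lies in no other clique of $\mathcal C$; similarly for stable sets in $\mathcal S$. The cover is minimal if no proper subset of $\mathcal C$ covers $V(G)$ and no proper subset of $\mathcal S$ covers $V(G)$ (equivalently, every member of $\mathcal C$ and of $\mathcal S$ has a private vertex). A set of vertices $\{v_1,\dots,v_{|\mathcal C|}\}$ is a set of clique generators for $\mathcal C$ if there is a bijection $v_i\mapsto C_i\in\mathcal C$ with $v_i$ private to $C_i$ for each $i$; stable set generators for $\mathcal S$ are defined analogously. -}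

module Defs where

open import Data.Nat using (ℕ; _≤_)
open import Data.Fin using (Fin)
open import Data.Fin.Subset using (Subset; _∈_; _∉_; ∣_∣)
open import Data.Bool using (Bool; true; false)
open import Data.Product using (Σ; ∃; _×_)
open import Relation.Binary.PropositionalEquality using (_≡_; _≢_)
open import Function.Definitions using (Injective)

record Graph (n : ℕ) : Set where
  field
    adj   : Fin n → Fin n → Bool
    sym   : ∀ u v → adj u v ≡ adj v u
    irrefl : ∀ v → adj v v ≡ false
open Graph public

module _ {n : ℕ} (G : Graph n) where

  IsClique : Subset n → Set
  IsClique C = ∀ u v → u ∈ C → v ∈ C → u ≢ v → adj G u v ≡ true

  IsStable : Subset n → Set
  IsStable S = ∀ u v → u ∈ S → v ∈ S → u ≢ v → adj G u v ≡ false

-- A finite *set* of vertex subsets, presented as an injectively indexed family.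
record Family (n : ℕ) : Set where
  field
    size : ℕ
    mem  : Fin size → Subset n
    inj  : Injective _≡_ _≡_ mem
open Family public

module _ {n : ℕ} where

  Covers : Family n → Set
  Covers F = ∀ (v : Fin n) → ∃ λ i → v ∈ mem F i

  -- no proper subset of the family covers V(G)
  -- (sub-families correspond to subsets T of the index set, by injectivity)
  MinimalCover : Family n → Set
  MinimalCover F =
    ∀ (T : Subset (size F)) →
      (∀ (v : Fin n) → ∃ λ i → i ∈ T × v ∈ mem F i) →
      ∀ i → i ∈ T

  Private : (F : Family n) → Fin (size F) → Fin n → Set
  Private F i v = v ∈ mem F i × (∀ j → v ∈ mem F j → j ≡ i)

  IsGenerators : Subset n → Family n → Set
  IsGenerators U F =
    Σ (Fin (size F) → Fin n) λ g →
      Injective _≡_ _≡_ g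
      × (∀ v → v ∈ U → ∃ λ i → g i ≡ v)
      × (∀ i → g i ∈ U)
      × (∀ i → Private F i (g i))

module _ {n : ℕ} (G : Graph n) (c s : ℕ) where

  IsNormalCover : Family n → Family n → Set
  IsNormalCover 𝒞 𝒮 =
      (∀ i → IsClique G (mem 𝒞 i) × ∣ mem 𝒞 i ∣ ≤ c)
    × (∀ j → IsStable G (mem 𝒮 j) × ∣ mem 𝒮 j ∣ ≤ s)
    × Covers 𝒞
    × Covers 𝒮
    × (∀ i j → ∃ λ v → v ∈ mem 𝒞 i × v ∈ mem 𝒮 j)

  IsMinimalNormalCover : Family n → Family n → Set
  IsMinimalNormalCover 𝒞 𝒮 =
    IsNormalCover 𝒞 𝒮 × MinimalCover 𝒞 × MinimalCover 𝒮

  IsNormalGraph : Set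
  IsNormalGraph = Σ (Family n) λ 𝒞 → Σ (Family n) λ 𝒮 → IsNormalCover 𝒞 𝒮

module Submission where

-- Let k = ∣ 𝒮 ∣.  The generator gS j ∈ U of the stable set S j also generates
-- a clique C (τ j).  A clique meets a stable set in at most one vertex and
-- generators are private, so (C (τ j) ∖ U) ∩ S j′ is empty for j = j′ and a
-- single vertex for j ≢ j′.  The k × k matrix of these intersection sizes is
-- therefore J − I, and it factors through the vertices outside U as the
-- product of two incidence matrices.  For k ≥ 2, J − I is nonsingular, so a
-- rank bound (proved by Gaussian elimination over ℤ) gives k ≤ ∣ ∁ U ∣; and
-- ∣ U ∣ ≤ k since U is the image of the stable set generators.  For k ≤ 1 the
-- claim follows from n ≥ 2.

open import Defs hiding (sym)
open import Data.Nat using (ℕ; _≤_; _<_; _*_)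
open import Data.Fin.Subset using (Subset; ∣_∣)

open import Data.Nat as ℕ using (zero; suc; s≤s)
import Data.Nat.Properties as ℕP
open import Data.Integer as ℤ using (ℤ; +_; -_; 0ℤ; 1ℤ) renaming (_+_ to _+ℤ_; _*_ to _*ℤ_; _-_ to _-ℤ_)
import Data.Integer.Properties as ℤP
open import Data.Integer.Tactic.RingSolver using (solve-∀)
open import Data.Fin as Fin using (Fin; zero; suc; punchIn)
open import Data.Fin.Properties using (punchInᵢ≢i; ¬∀⟶∃¬; all?)
open import Data.Fin.Subset using (_∈_; _∉_; _⊆_; _∩_; ∁; _-_; ⁅_⁆; ⊥; inside; outside)
open import Data.Fin.Subset.Properties
  using (_∈?_; x∈p∩q⁺; x∈p∩q⁻; x∈∁p⇒x∉p; x∉p⇒x∈∁p; ∣∁p∣≡n∸∣p∣; ∣p∣≤n; p⊆q⇒∣p∣≤∣q∣; ∣⊥∣≡0;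
         drop-there; x∈p∧x≢y⇒x∈p-y; p─q─q≡p─q; p─q⊆p; x∈p⇒∣p-x∣<∣p∣)
open import Data.Vec using ([]; _∷_; lookup; tail; here; there)
open import Data.Vec.Properties using ([]=⇒lookup; lookup⇒[]=; lookup-zipWith)
open import Data.Vec.Functional using (Vector; insertAt; removeAt)
open import Data.Vec.Functional.Properties using (insertAt-lookup; insertAt-punchIn)
open import Data.Bool using (Bool; true; false; _∧_)
open import Data.Product using (Σ; ∃; _×_; _,_; proj₁; proj₂)
open import Data.Sum using (inj₁; inj₂)
open import Data.Empty using (⊥-elim)
open import Relation.Nullary using (¬_; Dec; yes; no; contradiction)
open import Relation.Binary.PropositionalEquality
open import Function using (_∘_)

open import Algebra.Properties.Semiring.Sum ℤP.+-*-semiring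
  using (sum; sum-cong-≗; sum-replicate-zero; sum-remove; ∑-distrib-+; ∑-comm;
         *-distribˡ-sum; *-distribʳ-sum)

sum-zero : ∀ {k} {f : Vector ℤ k} → (∀ i → f i ≡ 0ℤ) → sum f ≡ 0ℤ
sum-zero {k} f≡0 = trans (sum-cong-≗ f≡0) (sum-replicate-zero k)

sum-single : ∀ {k} (f : Vector ℤ (suc k)) i → (∀ j → j ≢ i → f j ≡ 0ℤ) → sum f ≡ f i
sum-single f i off = begin
  sum f                          ≡⟨ sum-remove {i = i} f ⟩
  f i +ℤ sum (removeAt f i)      ≡⟨ cong (f i +ℤ_) (sum-zero (λ j → off (punchIn i j) (punchInᵢ≢i i j))) ⟩
  f i +ℤ 0ℤ                      ≡⟨ ℤP.+-identityʳ (f i) ⟩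
  f i                            ∎
  where open ≡-Reasoning

sum-const : ∀ k (x : ℤ) → sum {k} (λ _ → x) ≡ + k *ℤ x
sum-const zero    x = refl
sum-const (suc k) x = begin
  x +ℤ sum {k} (λ _ → x)   ≡⟨ cong (x +ℤ_) (sum-const k x) ⟩
  x +ℤ + k *ℤ x            ≡⟨ cong (_+ℤ + k *ℤ x) (ℤP.*-identityˡ x) ⟨
  1ℤ *ℤ x +ℤ + k *ℤ x       ≡⟨ ℤP.*-distribʳ-+ x 1ℤ (+ k) ⟨
  (1ℤ +ℤ + k) *ℤ x          ∎
  where open ≡-Reasoning

dot : ∀ {k} → Vector ℤ k → Vector ℤ k → ℤ
dot a z = sum (λ i → a i *ℤ z i)

-- One step of Gaussian elimination, with pivot entry a q ≢ 0 of the row a.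
-- Every row c is reduced to a row in one unknown fewer (eliminating the
-- q-th unknown against a), and a solution z′ of the reduced system is lifted
-- back; the identity dot-lift shows that the lift solves the row c exactly
-- when z′ solves its reduction, and the pivot row reduces to zero.
module Pivot {k} (a : Vector ℤ (suc k)) (q : Fin (suc k)) where

  reduce : Vector ℤ (suc k) → Vector ℤ k
  reduce c i = a q *ℤ c (punchIn q i) -ℤ c q *ℤ a (punchIn q i)

  lift : Vector ℤ k → Vector ℤ (suc k)
  lift z′ = insertAt (λ i → a q *ℤ z′ i) q (- dot (removeAt a q) z′)

  dot-lift : ∀ c z′ → dot c (lift z′) ≡ dot (reduce c) z′
  dot-lift c z′ = begin
    dot c z
      ≡⟨ sum-remove {i = q} (λ j → c j *ℤ z j) ⟩
    c q *ℤ z q +ℤ sum (λ i → c (punchIn q i) *ℤ z (punchIn q i))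
      ≡⟨ cong₂ (λ x y → c q *ℤ x +ℤ y) (insertAt-lookup _ q _)
               (sum-cong-≗ (λ i → cong (c (punchIn q i) *ℤ_) (insertAt-punchIn _ q _ i))) ⟩
    c q *ℤ (- dot (removeAt a q) z′) +ℤ sum (λ i → c (punchIn q i) *ℤ (a q *ℤ z′ i))
      ≡⟨ cong (_+ℤ sum (λ i → c (punchIn q i) *ℤ (a q *ℤ z′ i)))
              (trans (neg-swap (c q) (dot (removeAt a q) z′))
                     (*-distribˡ-sum (- c q) (λ i → a (punchIn q i) *ℤ z′ i))) ⟩
    sum (λ i → (- c q) *ℤ (a (punchIn q i) *ℤ z′ i)) +ℤ sum (λ i → c (punchIn q i) *ℤ (a q *ℤ z′ i))
      ≡⟨ ∑-distrib-+ (λ i → (- c q) *ℤ (a (punchIn q i) *ℤ z′ i)) (λ i → c (punchIn q i) *ℤ (a q *ℤ z′ i)) ⟨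
    sum (λ i → (- c q) *ℤ (a (punchIn q i) *ℤ z′ i) +ℤ c (punchIn q i) *ℤ (a q *ℤ z′ i))
      ≡⟨ sum-cong-≗ (λ i → regroup (c q) (a (punchIn q i)) (c (punchIn q i)) (a q) (z′ i)) ⟩
    dot (reduce c) z′ ∎
    where
    open ≡-Reasoning
    z = lift z′
    neg-swap : ∀ x y → x *ℤ (- y) ≡ (- x) *ℤ y
    neg-swap = solve-∀
    regroup : ∀ cq ai ci aq zi → (- cq) *ℤ (ai *ℤ zi) +ℤ ci *ℤ (aq *ℤ zi) ≡ (aq *ℤ ci -ℤ cq *ℤ ai) *ℤ zi
    regroup = solve-∀

  -- The pivot row reduces to the zero row, so every lift solves it.
  reduce-pivot : ∀ i → reduce a i ≡ 0ℤ
  reduce-pivot i = ℤP.+-inverseʳ (a q *ℤ a (punchIn q i))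

  lift-nonzero : a q ≢ 0ℤ → ∀ z′ i → z′ i ≢ 0ℤ → lift z′ (punchIn q i) ≢ 0ℤ
  lift-nonzero aq≢0 z′ i z′i≢0 e
    with ℤP.i*j≡0⇒i≡0∨j≡0 (a q) (trans (sym (insertAt-punchIn _ q _ i)) e)
  ... | inj₁ aq≡0  = aq≢0 aq≡0
  ... | inj₂ z′i≡0 = z′i≢0 z′i≡0

NontrivialSolution : ∀ {r k} → (Fin r → Vector ℤ k) → Subset r → Set
NontrivialSolution {k = k} rows p =
  Σ (Vector ℤ k) λ z → (∃ λ i → z i ≢ 0ℤ) × (∀ t → t ∈ p → dot (rows t) z ≡ 0ℤ)

-- By induction on the rows: a selected row that is identically
-- zero is dropped; otherwise it supplies a pivot, the remaining rows are
-- reduced (Pivot) and a solution in one unknown fewer is lifted back.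
nontrivial-solution : ∀ {r k} (rows : Fin r → Vector ℤ k) (p : Subset r) →
                      ∣ p ∣ < k → NontrivialSolution rows p
nontrivial-solution {zero} {suc k} rows [] _ = (λ _ → 1ℤ) , (zero , λ ()) , λ _ ()
nontrivial-solution {suc r} rows (outside ∷ p) lt
  with z , nz , solves ← nontrivial-solution (rows ∘ suc) p lt
  = z , nz , λ { (suc t) (there t∈p) → solves t t∈p }
nontrivial-solution {suc r} {suc k} rows (inside ∷ p) (s≤s lt)
  with all? (λ i → rows zero i ℤ.≟ 0ℤ)
... | yes zero-row
  with z , nz , solves ← nontrivial-solution (rows ∘ suc) p (ℕP.m≤n⇒m≤1+n lt)
  = z , nz , λ { zero here → sum-zero (λ i → cong (_*ℤ z i) (zero-row i))
               ; (suc t) (there t∈p) → solves t t∈p }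
... | no ¬zero-row
  with q , aq≢0 ← ¬∀⟶∃¬ _ _ (λ i → rows zero i ℤ.≟ 0ℤ) ¬zero-row
  with z′ , (i , z′i≢0) , solves ← nontrivial-solution (Pivot.reduce (rows zero) q ∘ rows ∘ suc) p lt
  = lift z′ , (punchIn q i , lift-nonzero aq≢0 z′ i z′i≢0)
  , λ { zero here → trans (dot-lift (rows zero) z′) (sum-zero (λ j → cong (_*ℤ z′ j) (reduce-pivot j)))
      ; (suc t) (there t∈p) → trans (dot-lift (rows (suc t)) z′) (solves t t∈p) }
  where open Pivot (rows zero) q

TrivialKernel : ∀ {k} → (Fin k → Vector ℤ k) → Set
TrivialKernel {k} M = (z : Vector ℤ k) → (∀ j → dot (M j) z ≡ 0ℤ) → ∀ j → z j ≡ 0ℤ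

_⊗_ : ∀ {k n m} → (Fin k → Vector ℤ n) → (Fin n → Vector ℤ m) → Fin k → Vector ℤ m
(L ⊗ R) j j′ = sum (λ w → L j w *ℤ R w j′)

dot-⊗ : ∀ {k n m} (L : Fin k → Vector ℤ n) (R : Fin n → Vector ℤ m) z j →
        dot ((L ⊗ R) j) z ≡ sum (λ w → L j w *ℤ dot (R w) z)
dot-⊗ L R z j = begin
  sum (λ j′ → sum (λ w → L j w *ℤ R w j′) *ℤ z j′)
    ≡⟨ sum-cong-≗ (λ j′ → *-distribʳ-sum (z j′) (λ w → L j w *ℤ R w j′)) ⟩
  sum (λ j′ → sum (λ w → L j w *ℤ R w j′ *ℤ z j′))
    ≡⟨ ∑-comm (λ j′ w → L j w *ℤ R w j′ *ℤ z j′) ⟩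
  sum (λ w → sum (λ j′ → L j w *ℤ R w j′ *ℤ z j′))
    ≡⟨ sum-cong-≗ (λ w → sum-cong-≗ (λ j′ → ℤP.*-assoc (L j w) (R w j′) (z j′))) ⟩
  sum (λ w → sum (λ j′ → L j w *ℤ (R w j′ *ℤ z j′)))
    ≡⟨ sum-cong-≗ (λ w → *-distribˡ-sum (L j w) (λ j′ → R w j′ *ℤ z j′)) ⟨
  sum (λ w → L j w *ℤ dot (R w) z) ∎
  where open ≡-Reasoning

-- Rank bound: a nonsingular k × k matrix L R whose factor L is supported on
-- the columns p forces k ≤ ∣ p ∣.  Otherwise the rows of R indexed by p have
-- a common nontrivial null vector z, and then (L R) z = L (R z) = 0.
rank-bound : ∀ {k n} (L : Fin k → Vector ℤ n) (R : Fin n → Vector ℤ k) (p : Subset n) →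
             (∀ j w → w ∉ p → L j w ≡ 0ℤ) → TrivialKernel (L ⊗ R) → k ≤ ∣ p ∣
rank-bound {k} L R p supported nonsingular with k ℕ.≤? ∣ p ∣
... | yes k≤∣p∣ = k≤∣p∣
... | no k≰∣p∣
  with z , (i , zi≢0) , solves ← nontrivial-solution R p (ℕP.≰⇒> k≰∣p∣)
  = contradiction (nonsingular z (λ j → trans (dot-⊗ L R z j) (sum-zero (vanish j))) i) zi≢0
  where
  vanish : ∀ j w → L j w *ℤ dot (R w) z ≡ 0ℤ
  vanish j w with w ∈? p
  ... | yes w∈p = trans (cong (L j w *ℤ_) (solves w w∈p)) (ℤP.*-zeroʳ (L j w))
  ... | no  w∉p = cong (_*ℤ dot (R w) z) (supported j w w∉p)

-- For k ≥ 2, a matrix with zero diagonal and ones elsewhere (J − I) is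
-- nonsingular: in the kernel every z j equals Σ z, hence Σ z = k · Σ z,
-- so Σ z = 0 and z = 0.
off-diagonal-ones-nonsingular : ∀ {k} → 2 ≤ k → (M : Fin k → Vector ℤ k) →
  (∀ j → M j j ≡ 0ℤ) → (∀ j j′ → j ≢ j′ → M j j′ ≡ 1ℤ) → TrivialKernel M
off-diagonal-ones-nonsingular {suc zero} (s≤s ())
off-diagonal-ones-nonsingular {suc (suc m)} _ M diagonal off-diagonal z kernel j = begin
  z j      ≡⟨ entry-is-total j ⟩
  sum z    ≡⟨ total≡0 ⟩
  0ℤ       ∎
  where
  open ≡-Reasoning
  row-sum : ∀ j → dot (M j) z ≡ sum (removeAt z j)
  row-sum j = begin
    dot (M j) z                                               ≡⟨ sum-remove {i = j} (λ i → M j i *ℤ z i) ⟩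
    M j j *ℤ z j +ℤ sum (λ i → M j (punchIn j i) *ℤ z (punchIn j i))
      ≡⟨ cong₂ (λ x y → x *ℤ z j +ℤ y) (diagonal j) (sum-cong-≗ off-entry) ⟩
    0ℤ +ℤ sum (removeAt z j)                                  ≡⟨ ℤP.+-identityˡ _ ⟩
    sum (removeAt z j)                                        ∎
    where
    off-entry : ∀ i → M j (punchIn j i) *ℤ z (punchIn j i) ≡ z (punchIn j i)
    off-entry i = trans (cong (_*ℤ z (punchIn j i)) (off-diagonal j (punchIn j i) (punchInᵢ≢i j i ∘ sym)))
                        (ℤP.*-identityˡ (z (punchIn j i)))

  -- In the kernel, Σ z = z j + dot (M j) z = z j.
  entry-is-total : ∀ j → z j ≡ sum z
  entry-is-total j = sym (begin
    sum z                        ≡⟨ sum-remove {i = j} z ⟩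
    z j +ℤ sum (removeAt z j)    ≡⟨ cong (z j +ℤ_) (trans (sym (row-sum j)) (kernel j)) ⟩
    z j +ℤ 0ℤ                    ≡⟨ ℤP.+-identityʳ (z j) ⟩
    z j                          ∎)

  total-fixed : sum z ≡ sum z +ℤ + suc m *ℤ sum z
  total-fixed = trans (sum-cong-≗ entry-is-total) (cong (sum z +ℤ_) (sum-const (suc m) (sum z)))

  total≡0 : sum z ≡ 0ℤ
  total≡0 with ℤP.i*j≡0⇒i≡0∨j≡0 (+ suc m) (absorb (sum z) _ total-fixed)
    where
    absorb : ∀ x y → x ≡ x +ℤ y → y ≡ 0ℤ
    absorb x y e = trans (regroup x y) (trans (cong (_-ℤ x) (sym e)) (ℤP.+-inverseʳ x))
      where
      regroup : ∀ x y → y ≡ x +ℤ y -ℤ x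
      regroup = solve-∀
  ... | inj₁ ()
  ... | inj₂ total≡0 = total≡0

χ : Bool → ℤ
χ true  = 1ℤ
χ false = 0ℤ

𝟙 : ∀ {n} → Subset n → Vector ℤ n
𝟙 p v = χ (lookup p v)

𝟙-∈ : ∀ {n} {p : Subset n} {v} → v ∈ p → 𝟙 p v ≡ 1ℤ
𝟙-∈ v∈p = cong χ ([]=⇒lookup v∈p)

𝟙-∉ : ∀ {n} {p : Subset n} {v} → v ∉ p → 𝟙 p v ≡ 0ℤ
𝟙-∉ {p = p} {v} v∉p with lookup p v in eq
... | true  = contradiction (lookup⇒[]= v p eq) v∉p
... | false = refl

𝟙-∩ : ∀ {n} (p q : Subset n) v → 𝟙 (p ∩ q) v ≡ 𝟙 p v *ℤ 𝟙 q v
𝟙-∩ p q v rewrite lookup-zipWith _∧_ v p q = χ-∧ (lookup p v) (lookup q v)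
  where
  χ-∧ : ∀ x y → χ (x ∧ y) ≡ χ x *ℤ χ y
  χ-∧ true  y = sym (ℤP.*-identityˡ (χ y))
  χ-∧ false y = refl

sum-𝟙-empty : ∀ {n} (p : Subset n) → (∀ v → v ∉ p) → sum (𝟙 p) ≡ 0ℤ
sum-𝟙-empty p empty = sum-zero (λ v → 𝟙-∉ (empty v))

sum-𝟙-singleton : ∀ {n} (p : Subset n) v → v ∈ p → (∀ w → w ∈ p → w ≡ v) → sum (𝟙 p) ≡ 1ℤ
sum-𝟙-singleton {suc n} p v v∈p unique =
  trans (sum-single (𝟙 p) v (λ w w≢v → 𝟙-∉ (w≢v ∘ unique w))) (𝟙-∈ v∈p)

∈-remove⇒≢ : ∀ {n} {p : Subset n} {v x} → v ∈ p - x → v ≢ x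
∈-remove⇒≢ {p = p} {x = x} v∈p-x refl =
  ℕP.<-irrefl (cong ∣_∣ (p─q─q≡p─q p ⁅ x ⁆)) (x∈p⇒∣p-x∣<∣p∣ v∈p-x)

rest-kept : ∀ {n} b (p : Subset n) → p ⊆ tail ((b ∷ p) - zero)
rest-kept b p v∈p = drop-there (x∈p∧x≢y⇒x∈p-y {p = b ∷ p} {y = zero} (there v∈p) λ ())

∣p∣≤1+∣p-x∣ : ∀ {n} (p : Subset n) x → ∣ p ∣ ≤ suc ∣ p - x ∣
∣p∣≤1+∣p-x∣ (inside  ∷ p) zero    = s≤s (p⊆q⇒∣p∣≤∣q∣ (rest-kept inside p))
∣p∣≤1+∣p-x∣ (outside ∷ p) zero    = ℕP.m≤n⇒m≤1+n (p⊆q⇒∣p∣≤∣q∣ (rest-kept outside p))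
∣p∣≤1+∣p-x∣ (inside  ∷ p) (suc x) = s≤s (∣p∣≤1+∣p-x∣ p x)
∣p∣≤1+∣p-x∣ (outside ∷ p) (suc x) = ∣p∣≤1+∣p-x∣ p x

image-bound : ∀ {n} k (g : Fin k → Fin n) (p : Subset n) →
              (∀ v → v ∈ p → ∃ λ i → g i ≡ v) → ∣ p ∣ ≤ k
image-bound {n} zero g p covered =
  ℕP.≤-trans (p⊆q⇒∣p∣≤∣q∣ {q = ⊥} (λ {v} v∈p → ⊥-elim (nothing (covered v v∈p)))) (ℕP.≤-reflexive (∣⊥∣≡0 n))
  where
  nothing : ∀ {v} → ¬ (∃ λ (i : Fin 0) → g i ≡ v)
  nothing (() , _)
image-bound (suc k) g p covered =
  ℕP.≤-trans (∣p∣≤1+∣p-x∣ p (g zero)) (s≤s (image-bound k (g ∘ suc) (p - g zero) covered-rest))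
  where
  covered-rest : ∀ v → v ∈ p - g zero → ∃ λ i → g (suc i) ≡ v
  covered-rest v v∈rest with covered v (p─q⊆p p ⁅ g zero ⁆ v∈rest)
  ... | zero  , g0≡v = contradiction (sym g0≡v) (∈-remove⇒≢ v∈rest)
  ... | suc i , gi≡v = i , gi≡v

clique-stable-meet-once : ∀ {n} (G : Graph n) {C S : Subset n} → IsClique G C → IsStable G S →
                          ∀ {v w} → v ∈ C → v ∈ S → w ∈ C → w ∈ S → v ≡ w
clique-stable-meet-once G clique stable {v} {w} v∈C v∈S w∈C w∈S with v Fin.≟ w
... | yes v≡w = v≡w
... | no  v≢w with trans (sym (clique v w v∈C w∈C v≢w)) (stable v w v∈S w∈S v≢w)
...   | ()

module CommonGenerators {n} (G : Graph n) (𝒞 𝒮 : Family n)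
  (cliques : ∀ i → IsClique G (mem 𝒞 i)) (stables : ∀ j → IsStable G (mem 𝒮 j))
  (meet : ∀ i j → ∃ λ v → v ∈ mem 𝒞 i × v ∈ mem 𝒮 j)
  (U : Subset n)
  (gC : Fin (size 𝒞) → Fin n) (gC-onto : ∀ v → v ∈ U → ∃ λ i → gC i ≡ v)
  (gC-private : ∀ i → Private 𝒞 i (gC i))
  (gS : Fin (size 𝒮) → Fin n) (gS-in-U : ∀ j → gS j ∈ U) (gS-private : ∀ j → Private 𝒮 j (gS j))
  where

  k : ℕ
  k = size 𝒮

  C : Fin (size 𝒞) → Subset n
  C = mem 𝒞

  S : Fin k → Subset n
  S = mem 𝒮

  meet-once : ∀ i j {v w} → v ∈ C i → v ∈ S j → w ∈ C i → w ∈ S j → v ≡ w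
  meet-once i j = clique-stable-meet-once G (cliques i) (stables j)

  τ : Fin k → Fin (size 𝒞)
  τ j = proj₁ (gC-onto (gS j) (gS-in-U j))

  gS∈C : ∀ j → gS j ∈ C (τ j)
  gS∈C j = subst (_∈ C (τ j)) (proj₂ (gC-onto (gS j) (gS-in-U j))) (proj₁ (gC-private (τ j)))

  -- C (τ j) ∩ S j is just the common generator gS j, which lies in U.
  diagonal-in-U : ∀ j {w} → w ∈ C (τ j) → w ∈ S j → w ∈ U
  diagonal-in-U j w∈C w∈S =
    subst (_∈ U) (meet-once (τ j) j (gS∈C j) (proj₁ (gS-private j)) w∈C w∈S) (gS-in-U j)

  -- For j ≢ j′ the vertices of C (τ j) ∩ S j′ lie outside U: a generator v ∈ U
  -- in C (τ j) is private to it, so v = gS j, which is private to S j.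
  off-diagonal-outside-U : ∀ {j j′ v} → j ≢ j′ → v ∈ C (τ j) → v ∈ S j′ → v ∉ U
  off-diagonal-outside-U {j} {j′} {v} j≢j′ v∈C v∈S v∈U with gC-onto v v∈U
  ... | i , gCi≡v = j≢j′ (sym (proj₂ (gS-private j) j′ (subst (_∈ S j′) v≡gSj v∈S)))
    where
    τj≡i : τ j ≡ i
    τj≡i = proj₂ (gC-private i) (τ j) (subst (_∈ C (τ j)) (sym gCi≡v) v∈C)
    v≡gSj : v ≡ gS j
    v≡gSj = begin
      v          ≡⟨ gCi≡v ⟨
      gC i       ≡⟨ cong gC τj≡i ⟨
      gC (τ j)   ≡⟨ proj₂ (gC-onto (gS j) (gS-in-U j)) ⟩
      gS j       ∎
      where open ≡-Reasoning

  -- The incidence matrices of the sets C (τ j) ∖ U against the vertices, and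
  -- of the vertices against the stable sets; their product counts
  -- ∣ (C (τ j) ∖ U) ∩ S j′ ∣.
  L : Fin k → Vector ℤ n
  L j = 𝟙 (∁ U ∩ C (τ j))

  R : Fin n → Vector ℤ k
  R w j′ = 𝟙 (S j′) w

  count : ∀ j j′ → (L ⊗ R) j j′ ≡ sum (𝟙 ((∁ U ∩ C (τ j)) ∩ S j′))
  count j j′ = sum-cong-≗ (λ w → sym (𝟙-∩ (∁ U ∩ C (τ j)) (S j′) w))

  count-diagonal : ∀ j → (L ⊗ R) j j ≡ 0ℤ
  count-diagonal j = trans (count j j) (sum-𝟙-empty _ none)
    where
    none : ∀ w → w ∉ (∁ U ∩ C (τ j)) ∩ S j
    none w w∈ with x∈p∩q⁻ _ _ w∈
    ... | w∈∁U∩C , w∈S with x∈p∩q⁻ _ _ w∈∁U∩C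
    ...   | w∈∁U , w∈C = x∈∁p⇒x∉p w∈∁U (diagonal-in-U j w∈C w∈S)

  -- Off the diagonal the count is one: C (τ j) meets S j′ in a single vertex,
  -- which lies outside U.
  count-off-diagonal : ∀ j j′ → j ≢ j′ → (L ⊗ R) j j′ ≡ 1ℤ
  count-off-diagonal j j′ j≢j′ with meet (τ j) j′
  ... | v , v∈C , v∈S = trans (count j j′) (sum-𝟙-singleton _ v v∈ unique)
    where
    v∈ : v ∈ (∁ U ∩ C (τ j)) ∩ S j′
    v∈ = x∈p∩q⁺ (x∈p∩q⁺ (x∉p⇒x∈∁p (off-diagonal-outside-U j≢j′ v∈C v∈S) , v∈C) , v∈S)
    unique : ∀ w → w ∈ (∁ U ∩ C (τ j)) ∩ S j′ → w ≡ v
    unique w w∈ with x∈p∩q⁻ _ _ w∈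
    ... | w∈∁U∩C , w∈S = meet-once (τ j) j′ (proj₂ (x∈p∩q⁻ _ _ w∈∁U∩C)) w∈S v∈C v∈S

  -- L vanishes on U, so the rank bound applies with the columns ∁ U.
  L-supported : ∀ j w → w ∉ ∁ U → L j w ≡ 0ℤ
  L-supported j w w∉∁U = 𝟙-∉ (w∉∁U ∘ proj₁ ∘ x∈p∩q⁻ _ _)

  -- The count matrix is J − I, nonsingular for k ≥ 2, so there are at least k
  -- vertices outside U.
  k≤∣∁U∣ : 2 ≤ k → k ≤ ∣ ∁ U ∣
  k≤∣∁U∣ 2≤k = rank-bound L R (∁ U) L-supported
    (off-diagonal-ones-nonsingular 2≤k (L ⊗ R) count-diagonal count-off-diagonal)

at-most-half : ∀ {n} (p : Subset n) → ∣ p ∣ ≤ ∣ ∁ p ∣ → 2 * ∣ p ∣ ≤ n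
at-most-half {n} p ∣p∣≤∣∁p∣ = begin
  2 * ∣ p ∣               ≡⟨ cong (∣ p ∣ ℕ.+_) (ℕP.+-identityʳ ∣ p ∣) ⟩
  ∣ p ∣ ℕ.+ ∣ p ∣          ≤⟨ ℕP.+-monoʳ-≤ ∣ p ∣ (ℕP.≤-trans ∣p∣≤∣∁p∣ (ℕP.≤-reflexive (∣∁p∣≡n∸∣p∣ p))) ⟩
  ∣ p ∣ ℕ.+ (n ℕ.∸ ∣ p ∣)  ≡⟨ ℕP.m+[n∸m]≡n (∣p∣≤n p) ⟩
  n                       ∎
  where open ℕP.≤-Reasoning

lemma3 : (c s n : ℕ) → 1 ≤ c → 1 ≤ s → 1 < n →
    (G : Graph n) → IsNormalGraph G c s →
    (𝒞 𝒮 : Family n) → IsMinimalNormalCover G c s 𝒞 𝒮 →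
    (U : Subset n) → IsGenerators U 𝒞 → IsGenerators U 𝒮 →
    2 * ∣ U ∣ ≤ n
lemma3 c s n _ _ 2≤n G _ 𝒞 𝒮 ((sized-cliques , sized-stables , _ , _ , meet) , _ , _) U
       (gC , _ , gC-onto , _ , gC-private) (gS , _ , gS-onto , gS-in-U , gS-private) =
  by-cases (size 𝒮 ℕ.≤? 1)
  where
  open CommonGenerators G 𝒞 𝒮 (proj₁ ∘ sized-cliques) (proj₁ ∘ sized-stables) meet
                        U gC gC-onto gC-private gS gS-in-U gS-private

  ∣U∣≤k : ∣ U ∣ ≤ k
  ∣U∣≤k = image-bound k gS U gS-onto

  by-cases : Dec (k ≤ 1) → 2 * ∣ U ∣ ≤ n
  by-cases (yes k≤1) = ℕP.≤-trans (ℕP.*-monoʳ-≤ 2 (ℕP.≤-trans ∣U∣≤k k≤1)) 2≤n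
  by-cases (no  k≰1) = at-most-half U (ℕP.≤-trans ∣U∣≤k (k≤∣∁U∣ (ℕP.≰⇒> k≰1)))
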